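{- For every $\sigma\in A^s$ and every $\sigma$-normal form $P_\sigma$: $\mathrm{EqMFEL}\vdash P_\sigma\mathbin{\vee_\bullet}\mathsf F_\sigma=P_\sigma$ and $\mathrm{EqMFEL}\vdash P_\sigma\mathbin{\wedge_\bullet}\mathsf T_\sigma=P_\sigma$.
   Context: $A$ is a countable set of atoms; $A^s$ is the set of finite strings over $A$ with no atom occurring more than once. Terms are built from $\mathsf T,\mathsf F$, atoms, $\neg$, $\mathbin{\wedge_\bullet}$, $\mathbin{\vee_\bullet}$. $\sigma$-normal forms: for $\sigma=\epsilon$ they are $\mathsf T$ and $\mathsf F$; for $\sigma=a\rho$ ($a\in A$) they are the terms $(a\mathbin{\wedge_\bullet}P_1)\mathbin{\vee_\bullet}(\neg a\mathbin{\wedge_\bullet}P_2)$ with $P_1,P_2$ $\rho$-normal forms. $\mathsf T_\epsilon=\mathsf T$, $\mathsf T_{a\rho}=(a\mathbin{\wedge_\bullet}\mathsf T_\rho)\mathbin{\vee_\bullet}(\neg a\mathbin{\wedge_\bullet}\mathsf T_\rho)$; $\mathsf F_\epsilon=\mathsf F$, $\mathsf F_{a\rho}=(a\mathbin{\wedge_\bullet}\mathsf F_\rho)\mathbin{\vee_\bullet}(\neg a\mathbin{\wedge_\bullet}\mathsf F_\rho)$. $\mathrm{EqMFEL}$ consists of: $\mathsf F=\neg\mathsf T$; $x\mathbin{\vee_\bullet}y=\neg(\neg x\mathbin{\wedge_\bullet}\neg y)$; $\neg\neg x=x$; $(x\mathbin{\wedge_\bullet}y)\mathbin{\wedge_\bullet}z=x\mathbin{\wedge_\bullet}(y\mathbin{\wedge_\bullet}z)$;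 $\mathsf T\mathbin{\wedge_\bullet}x=x$; $x\mathbin{\wedge_\bullet}\mathsf T=x$; $x\mathbin{\wedge_\bullet}\mathsf F=\mathsf F\mathbin{\wedge_\bullet}x$; $\neg x\mathbin{\wedge_\bullet}\mathsf F=x\mathbin{\wedge_\bullet}\mathsf F$; $(x\mathbin{\wedge_\bullet}\mathsf F)\mathbin{\vee_\bullet}y=(x\mathbin{\vee_\bullet}\mathsf T)\mathbin{\wedge_\bullet}y$; $x\mathbin{\vee_\bullet}(y\mathbin{\wedge_\bullet}\mathsf F)=x\mathbin{\wedge_\bullet}(y\mathbin{\vee_\bullet}\mathsf T)$; $(x\mathbin{\vee_\bullet}y)\mathbin{\wedge_\bullet}z=(\neg x\mathbin{\wedge_\bullet}(y\mathbin{\wedge_\bullet}z))\mathbin{\vee_\bullet}(x\mathbin{\wedge_\bullet}z)$. $\vdash$ is derivability in equational logic. -}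

module Defs where

open import Data.Nat using (ℕ)
open import Data.List using (List; []; _∷_)
open import Data.List.Relation.Unary.Unique.Propositional using (Unique)

Atom : Set
Atom = ℕ

record Str : Set where
  constructor mkStr
  field
    atoms  : List Atom
    unique : Unique atoms

-- Terms over atoms, with additionally equation variables (x, y, z, ...)
-- so that the axioms of EqMFEL can be stated and instantiated.
data Term : Set where
  var  : ℕ → Term
  atom : Atom → Term
  𝐓 𝐅  : Term
  ¬_   : Term → Term
  _∧∙_ : Term → Term → Term
  _∨∙_ : Term → Term → Term

infix  9 ¬_
infixr 7 _∧∙_
infixr 6 _∨∙_

subst : (ℕ → Term) → Term → Term
subst s (var n)   = s n
subst s (atom a)  = atom a
subst s 𝐓         = 𝐓
subst s 𝐅         = 𝐅
subst s (¬ t)     = ¬ subst s t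
subst s (t ∧∙ u)  = subst s t ∧∙ subst s u
subst s (t ∨∙ u)  = subst s t ∨∙ subst s u

private
  x y z : Term
  x = var 0
  y = var 1
  z = var 2

data Axiom : Term → Term → Set where
  ax1  : Axiom 𝐅 (¬ 𝐓)
  ax2  : Axiom (x ∨∙ y) (¬ (¬ x ∧∙ ¬ y))
  ax3  : Axiom (¬ ¬ x) x
  ax4  : Axiom ((x ∧∙ y) ∧∙ z) (x ∧∙ (y ∧∙ z))
  ax5  : Axiom (𝐓 ∧∙ x) x
  ax6  : Axiom (x ∧∙ 𝐓) x
  ax7  : Axiom (x ∧∙ 𝐅) (𝐅 ∧∙ x)
  ax8  : Axiom (¬ x ∧∙ 𝐅) (x ∧∙ 𝐅)
  ax9  : Axiom ((x ∧∙ 𝐅) ∨∙ y) ((x ∨∙ 𝐓) ∧∙ y)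
  ax10 : Axiom (x ∨∙ (y ∧∙ 𝐅)) (x ∧∙ (y ∨∙ 𝐓))
  ax11 : Axiom ((x ∨∙ y) ∧∙ z) ((¬ x ∧∙ (y ∧∙ z)) ∨∙ (x ∧∙ z))

infix 4 EqMFEL⊢_≈_
data EqMFEL⊢_≈_ : Term → Term → Set where
  axiom  : ∀ {l r} → Axiom l r → (s : ℕ → Term) → EqMFEL⊢ subst s l ≈ subst s r
  refl   : ∀ {t} → EqMFEL⊢ t ≈ t
  sym    : ∀ {t u} → EqMFEL⊢ t ≈ u → EqMFEL⊢ u ≈ t
  trans  : ∀ {t u v} → EqMFEL⊢ t ≈ u → EqMFEL⊢ u ≈ v → EqMFEL⊢ t ≈ v
  cong¬  : ∀ {t u} → EqMFEL⊢ t ≈ u → EqMFEL⊢ ¬ t ≈ ¬ u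
  cong∧  : ∀ {t t' u u'} → EqMFEL⊢ t ≈ t' → EqMFEL⊢ u ≈ u' → EqMFEL⊢ t ∧∙ u ≈ t' ∧∙ u'
  cong∨  : ∀ {t t' u u'} → EqMFEL⊢ t ≈ t' → EqMFEL⊢ u ≈ u' → EqMFEL⊢ t ∨∙ u ≈ t' ∨∙ u'

data NF : List Atom → Term → Set where
  nfT : NF [] 𝐓
  nfF : NF [] 𝐅
  nf∷ : ∀ {a ρ P₁ P₂} → NF ρ P₁ → NF ρ P₂ →
        NF (a ∷ ρ) ((atom a ∧∙ P₁) ∨∙ (¬ atom a ∧∙ P₂))

T_ : List Atom → Term
T_ []      = 𝐓
T_ (a ∷ ρ) = (atom a ∧∙ T_ ρ) ∨∙ (¬ atom a ∧∙ T_ ρ)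

F_ : List Atom → Term
F_ []      = 𝐅
F_ (a ∷ ρ) = (atom a ∧∙ F_ ρ) ∨∙ (¬ atom a ∧∙ F_ ρ)

-- In EqMFEL, x ∨∙ 𝐓 behaves as "evaluate x for its side effect, then yield 𝐓".
-- Thus T_(aρ) ≈ (a ∨∙ 𝐓) ∧∙ T_ρ, and conjoining it to a normal form whose branch
-- has already evaluated a (or ¬ a) only re-evaluates that atom, which memorization
-- makes redundant; induction on σ gives P ∧∙ T_σ ≈ P.  The disjunctive claim reduces
-- to the conjunctive one because F_σ ≈ T_σ ∧∙ 𝐅 and ¬ F_σ ≈ T_σ, so axiom 10 turns
-- P ∨∙ F_σ into P ∧∙ T_σ.
module Submission where

open import Defs
open import Data.Product using (_×_; _,_)
open import Data.Nat using (ℕ; zero; suc)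
open import Data.List using ([]; _∷_)

infix 4 _≈_
_≈_ : Term → Term → Set
t ≈ u = EqMFEL⊢ t ≈ u

module ≈-Reasoning where
  infixr 2 _≈⟨_⟩_ _≈˘⟨_⟩_
  infix  3 _∎

  _≈⟨_⟩_ : ∀ t {u v} → t ≈ u → u ≈ v → t ≈ v
  t ≈⟨ p ⟩ q = trans p q

  _≈˘⟨_⟩_ : ∀ t {u v} → u ≈ t → u ≈ v → t ≈ v
  t ≈˘⟨ p ⟩ q = trans (sym p) q

  _∎ : ∀ t → t ≈ t
  t ∎ = refl

open ≈-Reasoning

[_,_,_] : Term → Term → Term → ℕ → Term
[ x , y , z ] zero          = x
[ x , y , z ] (suc zero)    = y
[ x , y , z ] (suc (suc _)) = z

𝐅≈¬𝐓 : 𝐅 ≈ ¬ 𝐓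
𝐅≈¬𝐓 = axiom ax1 [ 𝐓 , 𝐓 , 𝐓 ]

∨-defn : ∀ x y → x ∨∙ y ≈ ¬ (¬ x ∧∙ ¬ y)
∨-defn x y = axiom ax2 [ x , y , 𝐓 ]

¬-involutive : ∀ x → ¬ ¬ x ≈ x
¬-involutive x = axiom ax3 [ x , 𝐓 , 𝐓 ]

∧-assoc : ∀ x y z → (x ∧∙ y) ∧∙ z ≈ x ∧∙ (y ∧∙ z)
∧-assoc x y z = axiom ax4 [ x , y , z ]

∧-identityˡ : ∀ x → 𝐓 ∧∙ x ≈ x
∧-identityˡ x = axiom ax5 [ x , 𝐓 , 𝐓 ]

∧-identityʳ : ∀ x → x ∧∙ 𝐓 ≈ x
∧-identityʳ x = axiom ax6 [ x , 𝐓 , 𝐓 ]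

¬-∧𝐅 : ∀ x → ¬ x ∧∙ 𝐅 ≈ x ∧∙ 𝐅
¬-∧𝐅 x = axiom ax8 [ x , 𝐓 , 𝐓 ]

∧𝐅-∨ : ∀ x y → (x ∧∙ 𝐅) ∨∙ y ≈ (x ∨∙ 𝐓) ∧∙ y
∧𝐅-∨ x y = axiom ax9 [ x , y , 𝐓 ]

∨-∧𝐅 : ∀ x y → x ∨∙ (y ∧∙ 𝐅) ≈ x ∧∙ (y ∨∙ 𝐓)
∨-∧𝐅 x y = axiom ax10 [ x , y , 𝐓 ]

∨-∧-distribʳ : ∀ x y z → (x ∨∙ y) ∧∙ z ≈ (¬ x ∧∙ (y ∧∙ z)) ∨∙ (x ∧∙ z)
∨-∧-distribʳ x y z = axiom ax11 [ x , y , z ]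

¬𝐅≈𝐓 : ¬ 𝐅 ≈ 𝐓
¬𝐅≈𝐓 = trans (cong¬ 𝐅≈¬𝐓) (¬-involutive 𝐓)

¬-∨ : ∀ x y → ¬ (x ∨∙ y) ≈ ¬ x ∧∙ ¬ y
¬-∨ x y = trans (cong¬ (∨-defn x y)) (¬-involutive _)

¬-∧ : ∀ x y → ¬ (x ∧∙ y) ≈ ¬ x ∨∙ ¬ y
¬-∧ x y = sym (trans (∨-defn (¬ x) (¬ y)) (cong¬ (cong∧ (¬-involutive x) (¬-involutive y))))

∨-identityʳ : ∀ x → x ∨∙ 𝐅 ≈ x
∨-identityʳ x =
  x ∨∙ 𝐅          ≈⟨ ∨-defn x 𝐅 ⟩
  ¬ (¬ x ∧∙ ¬ 𝐅)  ≈⟨ cong¬ (cong∧ refl ¬𝐅≈𝐓) ⟩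
  ¬ (¬ x ∧∙ 𝐓)    ≈⟨ cong¬ (∧-identityʳ _) ⟩
  ¬ ¬ x           ≈⟨ ¬-involutive x ⟩
  x               ∎

∨𝐓≈¬∧𝐅 : ∀ x → x ∨∙ 𝐓 ≈ ¬ (x ∧∙ 𝐅)
∨𝐓≈¬∧𝐅 x = trans (∨-defn x 𝐓) (cong¬ (trans (cong∧ refl (sym 𝐅≈¬𝐓)) (¬-∧𝐅 x)))

¬-∨𝐓 : ∀ x → ¬ (x ∨∙ 𝐓) ≈ x ∧∙ 𝐅
¬-∨𝐓 x = trans (cong¬ (∨𝐓≈¬∧𝐅 x)) (¬-involutive _)

¬-∨𝐓-same : ∀ x → ¬ x ∨∙ 𝐓 ≈ x ∨∙ 𝐓
¬-∨𝐓-same x = trans (∨𝐓≈¬∧𝐅 (¬ x)) (trans (cong¬ (¬-∧𝐅 x)) (sym (∨𝐓≈¬∧𝐅 x)))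

∨≈¬∧∨ : ∀ x y → x ∨∙ y ≈ (¬ x ∧∙ y) ∨∙ x
∨≈¬∧∨ x y =
  x ∨∙ y                               ≈˘⟨ ∧-identityʳ _ ⟩
  (x ∨∙ y) ∧∙ 𝐓                        ≈⟨ ∨-∧-distribʳ x y 𝐓 ⟩
  (¬ x ∧∙ (y ∧∙ 𝐓)) ∨∙ (x ∧∙ 𝐓)        ≈⟨ cong∨ (cong∧ refl (∧-identityʳ y)) (∧-identityʳ x) ⟩
  (¬ x ∧∙ y) ∨∙ x                      ∎

∧≈¬∨∧ : ∀ x y → x ∧∙ y ≈ (¬ x ∨∙ y) ∧∙ x
∧≈¬∨∧ x y =
  x ∧∙ y                       ≈˘⟨ ¬-involutive _ ⟩
  ¬ ¬ (x ∧∙ y)                 ≈⟨ cong¬ (¬-∧ x y) ⟩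
  ¬ (¬ x ∨∙ ¬ y)               ≈⟨ cong¬ (∨≈¬∧∨ (¬ x) (¬ y)) ⟩
  ¬ ((¬ ¬ x ∧∙ ¬ y) ∨∙ ¬ x)    ≈⟨ ¬-∨ _ _ ⟩
  ¬ (¬ ¬ x ∧∙ ¬ y) ∧∙ ¬ ¬ x    ≈⟨ cong∧ (¬-∧ _ _) (¬-involutive x) ⟩
  (¬ ¬ ¬ x ∨∙ ¬ ¬ y) ∧∙ x      ≈⟨ cong∧ (cong∨ (¬-involutive _) (¬-involutive y)) refl ⟩
  (¬ x ∨∙ y) ∧∙ x              ∎

∧𝐅-∨-absorb : ∀ x → (x ∧∙ 𝐅) ∨∙ x ≈ x
∧𝐅-∨-absorb x =
  (x ∧∙ 𝐅) ∨∙ x                  ≈⟨ cong∨ (sym (¬-∧𝐅 x)) (sym (∧-identityʳ x)) ⟩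
  (¬ x ∧∙ 𝐅) ∨∙ (x ∧∙ 𝐓)         ≈˘⟨ cong∨ (cong∧ refl (∧-identityʳ 𝐅)) refl ⟩
  (¬ x ∧∙ (𝐅 ∧∙ 𝐓)) ∨∙ (x ∧∙ 𝐓)  ≈˘⟨ ∨-∧-distribʳ x 𝐅 𝐓 ⟩
  (x ∨∙ 𝐅) ∧∙ 𝐓                  ≈⟨ ∧-identityʳ _ ⟩
  x ∨∙ 𝐅                         ≈⟨ ∨-identityʳ x ⟩
  x                              ∎

∧-∨𝐓-absorb : ∀ x → x ∧∙ (x ∨∙ 𝐓) ≈ x
∧-∨𝐓-absorb x =
  x ∧∙ (x ∨∙ 𝐓)                    ≈˘⟨ cong∧ (∧𝐅-∨-absorb x) refl ⟩
  ((x ∧∙ 𝐅) ∨∙ x) ∧∙ (x ∨∙ 𝐓)      ≈˘⟨ cong∧ (cong∨ (¬-∨𝐓 x) refl) refl ⟩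
  (¬ (x ∨∙ 𝐓) ∨∙ x) ∧∙ (x ∨∙ 𝐓)    ≈˘⟨ ∧≈¬∨∧ _ _ ⟩
  (x ∨∙ 𝐓) ∧∙ x                    ≈˘⟨ ∧𝐅-∨ x x ⟩
  (x ∧∙ 𝐅) ∨∙ x                    ≈⟨ ∧𝐅-∨-absorb x ⟩
  x                                ∎

∨𝐓-∧-repeatʳ : ∀ x y → (x ∨∙ 𝐓) ∧∙ y ≈ ((x ∨∙ 𝐓) ∧∙ y) ∧∙ (x ∨∙ 𝐓)
∨𝐓-∧-repeatʳ x y =
  (x ∨∙ 𝐓) ∧∙ y                                   ≈˘⟨ ∧𝐅-∨ x y ⟩
  (x ∧∙ 𝐅) ∨∙ y                                   ≈˘⟨ ∧-identityʳ _ ⟩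
  ((x ∧∙ 𝐅) ∨∙ y) ∧∙ 𝐓                            ≈⟨ ∨-∧-distribʳ _ _ _ ⟩
  (¬ (x ∧∙ 𝐅) ∧∙ (y ∧∙ 𝐓)) ∨∙ ((x ∧∙ 𝐅) ∧∙ 𝐓)     ≈⟨ cong∨ (cong∧ refl (∧-identityʳ y)) (∧-identityʳ _) ⟩
  (¬ (x ∧∙ 𝐅) ∧∙ y) ∨∙ (x ∧∙ 𝐅)                   ≈⟨ ∨-∧𝐅 _ _ ⟩
  (¬ (x ∧∙ 𝐅) ∧∙ y) ∧∙ (x ∨∙ 𝐓)                   ≈˘⟨ cong∧ (cong∧ (∨𝐓≈¬∧𝐅 x) refl) refl ⟩
  ((x ∨∙ 𝐓) ∧∙ y) ∧∙ (x ∨∙ 𝐓)                     ∎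

∨𝐓-∧-redundant : ∀ x w t → (x ∨∙ 𝐓) ∧∙ (w ∧∙ ((x ∨∙ 𝐓) ∧∙ t)) ≈ (x ∨∙ 𝐓) ∧∙ (w ∧∙ t)
∨𝐓-∧-redundant x w t =
  (x ∨∙ 𝐓) ∧∙ (w ∧∙ ((x ∨∙ 𝐓) ∧∙ t))   ≈˘⟨ ∧-assoc _ _ _ ⟩
  ((x ∨∙ 𝐓) ∧∙ w) ∧∙ ((x ∨∙ 𝐓) ∧∙ t)   ≈˘⟨ ∧-assoc _ _ _ ⟩
  (((x ∨∙ 𝐓) ∧∙ w) ∧∙ (x ∨∙ 𝐓)) ∧∙ t   ≈˘⟨ cong∧ (∨𝐓-∧-repeatʳ x w) refl ⟩
  ((x ∨∙ 𝐓) ∧∙ w) ∧∙ t                 ≈⟨ ∧-assoc _ _ _ ⟩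
  (x ∨∙ 𝐓) ∧∙ (w ∧∙ t)                 ∎

∧-∨𝐓-redundant : ∀ x w t → x ∧∙ (w ∧∙ ((x ∨∙ 𝐓) ∧∙ t)) ≈ x ∧∙ (w ∧∙ t)
∧-∨𝐓-redundant x w t =
  x ∧∙ (w ∧∙ ((x ∨∙ 𝐓) ∧∙ t))                  ≈˘⟨ cong∧ (∧-∨𝐓-absorb x) refl ⟩
  (x ∧∙ (x ∨∙ 𝐓)) ∧∙ (w ∧∙ ((x ∨∙ 𝐓) ∧∙ t))    ≈⟨ ∧-assoc _ _ _ ⟩
  x ∧∙ ((x ∨∙ 𝐓) ∧∙ (w ∧∙ ((x ∨∙ 𝐓) ∧∙ t)))    ≈⟨ cong∧ refl (∨𝐓-∧-redundant x w t) ⟩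
  x ∧∙ ((x ∨∙ 𝐓) ∧∙ (w ∧∙ t))                  ≈˘⟨ ∧-assoc _ _ _ ⟩
  (x ∧∙ (x ∨∙ 𝐓)) ∧∙ (w ∧∙ t)                  ≈⟨ cong∧ (∧-∨𝐓-absorb x) refl ⟩
  x ∧∙ (w ∧∙ t)                                ∎

branches-same : ∀ x t → (x ∧∙ t) ∨∙ (¬ x ∧∙ t) ≈ (x ∨∙ 𝐓) ∧∙ t
branches-same x t =
  (x ∧∙ t) ∨∙ (¬ x ∧∙ t)             ≈˘⟨ cong∨ (cong∧ (¬-involutive x) (∧-identityˡ t)) refl ⟩
  (¬ ¬ x ∧∙ (𝐓 ∧∙ t)) ∨∙ (¬ x ∧∙ t)  ≈˘⟨ ∨-∧-distribʳ (¬ x) 𝐓 t ⟩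
  (¬ x ∨∙ 𝐓) ∧∙ t                    ≈⟨ cong∧ (¬-∨𝐓-same x) refl ⟩
  (x ∨∙ 𝐓) ∧∙ t                      ∎

Tσ∧𝐅≈Fσ : ∀ ρ → T_ ρ ∧∙ 𝐅 ≈ F_ ρ
Tσ∧𝐅≈Fσ []      = ∧-identityˡ 𝐅
Tσ∧𝐅≈Fσ (a ∷ ρ) =
  T_ (a ∷ ρ) ∧∙ 𝐅                  ≈⟨ cong∧ (branches-same (atom a) (T_ ρ)) refl ⟩
  ((atom a ∨∙ 𝐓) ∧∙ T_ ρ) ∧∙ 𝐅     ≈⟨ ∧-assoc _ _ _ ⟩
  (atom a ∨∙ 𝐓) ∧∙ (T_ ρ ∧∙ 𝐅)     ≈⟨ cong∧ refl (Tσ∧𝐅≈Fσ ρ) ⟩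
  (atom a ∨∙ 𝐓) ∧∙ F_ ρ            ≈˘⟨ branches-same (atom a) (F_ ρ) ⟩
  F_ (a ∷ ρ)                       ∎

¬Fσ≈Tσ : ∀ ρ → ¬ F_ ρ ≈ T_ ρ
¬Fσ≈Tσ []      = ¬𝐅≈𝐓
¬Fσ≈Tσ (a ∷ ρ) =
  ¬ F_ (a ∷ ρ)                        ≈⟨ cong¬ (branches-same (atom a) (F_ ρ)) ⟩
  ¬ ((atom a ∨∙ 𝐓) ∧∙ F_ ρ)           ≈⟨ ¬-∧ _ _ ⟩
  ¬ (atom a ∨∙ 𝐓) ∨∙ ¬ F_ ρ           ≈⟨ cong∨ (¬-∨𝐓 (atom a)) (¬Fσ≈Tσ ρ) ⟩
  (atom a ∧∙ 𝐅) ∨∙ T_ ρ               ≈⟨ ∧𝐅-∨ _ _ ⟩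
  (atom a ∨∙ 𝐓) ∧∙ T_ ρ               ≈˘⟨ branches-same (atom a) (T_ ρ) ⟩
  T_ (a ∷ ρ)                          ∎

NF-∧-T : ∀ {ρ P} → NF ρ P → P ∧∙ T_ ρ ≈ P
NF-∧-T nfT = ∧-identityʳ 𝐓
NF-∧-T nfF = ∧-identityʳ 𝐅
NF-∧-T {a ∷ ρ} (nf∷ {P₁ = P₁} {P₂ = P₂} n₁ n₂) =
  (a∧P₁ ∨∙ ¬a∧P₂) ∧∙ T_ (a ∷ ρ)                           ≈⟨ ∨-∧-distribʳ _ _ _ ⟩
  (¬ a∧P₁ ∧∙ (¬a∧P₂ ∧∙ T_ (a ∷ ρ))) ∨∙ (a∧P₁ ∧∙ T_ (a ∷ ρ)) ≈⟨ cong∨ (cong∧ refl (branch (¬ atom a) (¬-∨𝐓-same (atom a)) n₂))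
                                                                     (branch (atom a) refl n₁) ⟩
  (¬ a∧P₁ ∧∙ ¬a∧P₂) ∨∙ a∧P₁                               ≈˘⟨ ∨≈¬∧∨ _ _ ⟩
  a∧P₁ ∨∙ ¬a∧P₂                                           ∎
  where
  a∧P₁ ¬a∧P₂ : Term
  a∧P₁ = atom a ∧∙ P₁
  ¬a∧P₂ = ¬ atom a ∧∙ P₂

  branch : ∀ ℓ {Q} → ℓ ∨∙ 𝐓 ≈ atom a ∨∙ 𝐓 → NF ρ Q → (ℓ ∧∙ Q) ∧∙ T_ (a ∷ ρ) ≈ ℓ ∧∙ Q
  branch ℓ {Q} ℓ∨𝐓≈a∨𝐓 n =
    (ℓ ∧∙ Q) ∧∙ T_ (a ∷ ρ)              ≈⟨ ∧-assoc _ _ _ ⟩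
    ℓ ∧∙ (Q ∧∙ T_ (a ∷ ρ))              ≈⟨ cong∧ refl (cong∧ refl (branches-same (atom a) (T_ ρ))) ⟩
    ℓ ∧∙ (Q ∧∙ ((atom a ∨∙ 𝐓) ∧∙ T_ ρ)) ≈˘⟨ cong∧ refl (cong∧ refl (cong∧ ℓ∨𝐓≈a∨𝐓 refl)) ⟩
    ℓ ∧∙ (Q ∧∙ ((ℓ ∨∙ 𝐓) ∧∙ T_ ρ))      ≈⟨ ∧-∨𝐓-redundant ℓ Q (T_ ρ) ⟩
    ℓ ∧∙ (Q ∧∙ T_ ρ)                    ≈⟨ cong∧ refl (NF-∧-T n) ⟩
    ℓ ∧∙ Q                              ∎

NF-∨-F : ∀ {ρ P} → NF ρ P → P ∨∙ F_ ρ ≈ P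
NF-∨-F {ρ} {P} n =
  P ∨∙ F_ ρ          ≈˘⟨ cong∨ refl (Tσ∧𝐅≈Fσ ρ) ⟩
  P ∨∙ (T_ ρ ∧∙ 𝐅)   ≈⟨ ∨-∧𝐅 _ _ ⟩
  P ∧∙ (T_ ρ ∨∙ 𝐓)   ≈⟨ cong∧ refl (∨𝐓≈¬∧𝐅 _) ⟩
  P ∧∙ ¬ (T_ ρ ∧∙ 𝐅) ≈⟨ cong∧ refl (cong¬ (Tσ∧𝐅≈Fσ ρ)) ⟩
  P ∧∙ ¬ F_ ρ        ≈⟨ cong∧ refl (¬Fσ≈Tσ ρ) ⟩
  P ∧∙ T_ ρ          ≈⟨ NF-∧-T n ⟩
  P                  ∎

lemma4p11 : (σ : Str) (P : Term) → NF (Str.atoms σ) P →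
    (EqMFEL⊢ P ∨∙ F_ (Str.atoms σ) ≈ P) × (EqMFEL⊢ P ∧∙ T_ (Str.atoms σ) ≈ P)
lemma4p11 σ P n = NF-∨-F n , NF-∧-T n
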